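{- Let $P_0(x,z)=\sum_{n\ge 0}\sum_{k=0}^{n}p_{n,0,k}x^kz^n$ and $P_1(x,z)=\sum_{n\ge 1}\sum_{k=0}^{n}p_{n,1,k}x^kz^n$. Then $$P_1(x,z)=(1+z-xz)P_0(x,z)-1.$$ Furthermore, for every $n\ge 2$ and every $k$, $$p_{n,1,k}=\frac{2(n-k)}{n(n-1)}\binom{n}{k-1}\binom{n}{k}.$$
   Context: A Dyck path of semilength $n\ge 0$ is a lattice path in $\mathbb{Z}\times\mathbb{Z}$ from $(0,0)$ to $(2n,0)$ using up steps $U=(1,1)$ and down steps $D=(1,-1)$; it is allowed to go below the $x$-axis. Write it as a word $P_1P_2\cdots P_{2n}$ over $\{U,D\}$. An up step is under the $x$-axis if it goes from height $-h$ to height $-h+1$ for some $h\ge 1$. A Dyck path is $(n,m)$-flawed if it has semilength $n$ and exactly $m$ up steps under the $x$-axis. A peak is a position $i$ with $P_iP_{i+1}=UD$. Let $p_{n,m,k}$ be the number of $(n,m)$-flawed paths with exactly $k$ peaks. Binomial coefficients with negative lower index are $0$. -}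

module Defs where

open import Data.Bool using (Bool; true; false; if_then_else_; _∧_)
open import Data.Nat using (ℕ; zero; suc; _+_; _*_; _≡ᵇ_; _≤ᵇ_)
open import Data.Nat.Combinatorics using (_C_)
open import Data.Integer as ℤ using (ℤ; +_; -[1+_]; _-_)
open import Data.List using (List; []; _∷_; _++_; map; length; filter)
open import Relation.Nullary using (does)
open import Relation.Unary using (Decidable)
open import Relation.Binary.PropositionalEquality using (_≡_)

-- Steps of a lattice path: U = (1,1), D = (1,-1)
data Step : Set where
  U D : Step

words : ℕ → List (List Step)
words zero = [] ∷ []
words (suc l) = map (U ∷_) (words l) ++ map (D ∷_) (words l)

endHeight : ℤ → List Step → ℤ
endHeight h [] = h
endHeight h (U ∷ w) = endHeight (h ℤ.+ + 1) w
endHeight h (D ∷ w) = endHeight (h ℤ.- + 1) w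

isNeg : ℤ → Bool
isNeg (+ _) = false
isNeg -[1+ _ ] = true

underUps : ℤ → List Step → ℕ
underUps h [] = 0
underUps h (U ∷ w) = (if isNeg h then 1 else 0) + underUps (h ℤ.+ + 1) w
underUps h (D ∷ w) = underUps (h ℤ.- + 1) w

peaks : List Step → ℕ
peaks (U ∷ D ∷ w) = suc (peaks (D ∷ w))
peaks (_ ∷ w) = peaks w
peaks [] = 0

isZeroℤ : ℤ → Bool
isZeroℤ (+ zero) = true
isZeroℤ _ = false

good : ℕ → ℕ → List Step → Bool
good m k w = isZeroℤ (endHeight (+ 0) w) ∧ (underUps (+ 0) w ≡ᵇ m) ∧ (peaks w ≡ᵇ k)

count : {A : Set} → (A → Bool) → List A → ℕ
count f [] = 0
count f (x ∷ xs) = (if f x then 1 else 0) + count f xs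

p : ℕ → ℕ → ℕ → ℕ
p n m k = count (good m k) (words (2 * n))

-- Formal power series in x, z with integer coefficients:
-- S n k is the coefficient of x^k z^n.
Series : Set
Series = ℕ → ℕ → ℤ

_⊕_ : Series → Series → Series
(f ⊕ g) n k = f n k ℤ.+ g n k

_⊖_ : Series → Series → Series
(f ⊖ g) n k = f n k ℤ.- g n k

zMul : Series → Series
zMul f zero k = + 0
zMul f (suc n) k = f n k

xzMul : Series → Series
xzMul f (suc n) (suc k) = f n k
xzMul f _ _ = + 0

one : Series
one zero zero = + 1
one _ _ = + 0

P₀ : Series
P₀ n k = if k ≤ᵇ n then + p n 0 k else + 0

P₁ : Series
P₁ n k = if (1 ≤ᵇ n) ∧ (k ≤ᵇ n) then + p n 1 k else + 0

-- binomial n (k-1), zero when k-1 < 0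
binomPred : ℕ → ℕ → ℕ
binomPred n zero = 0
binomPred n (suc k) = n C k

-- Count walks by their first step. For walks from height h back to 0, record whether the
-- previous step was U (then a leading D completes a peak). With d down and u up steps, the
-- flawless walks are counted by the Lindström–Gessel–Viennot determinant
-- C(u-1,k-1) C(d,k) - C(u-1,k) C(d,k-1), the walks with one flaw by determinants of the same
-- kind and their differences in d. These closed forms satisfy the first-step recursion since,
-- by Pascal's rule, it amounts to bilinearity of 2×2 determinants. The series identity is that
-- recursion once more, and the formula for p n 1 k follows from the absorption identities for
-- binomial coefficients.
module Submission where

open import Defs
open import Data.Bool using (Bool; true; false; _∧_; T; if_then_else_)
open import Data.Bool.Properties using (¬-not; ∧-zeroʳ)
open import Data.Integer as ℤ using (ℤ; +_; -[1+_])
import Data.Integer.Properties as ℤₚ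
open import Data.List using (List; []; _∷_; _++_; map; length)
open import Data.Nat as ℕ using (ℕ; zero; suc; _≡ᵇ_; _≤_; _<_; z≤n; s≤s)
import Data.Nat.Properties as ℕₚ
open import Data.Nat.Combinatorics using (_C_; nC1≡n; nCk+nC[k+1]≡[n+1]C[k+1])
open import Data.Product using (_×_; _,_)
open import Function using (_∘_)
open import Relation.Binary.PropositionalEquality

module Walks where

  open import Data.Nat using (_+_)
  open import Data.Integer using (_-_)

  count-++ : ∀ {A : Set} (f : A → Bool) xs ys → count f (xs ++ ys) ≡ count f xs + count f ys
  count-++ f []       ys = refl
  count-++ f (x ∷ xs) ys =
    trans (cong₂ _+_ refl (count-++ f xs ys)) (sym (ℕₚ.+-assoc (if f x then 1 else 0) _ _))

  count-map : ∀ {A B : Set} (f : B → Bool) (g : A → B) xs → count f (map g xs) ≡ count (f ∘ g) xs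
  count-map f g []       = refl
  count-map f g (x ∷ xs) = cong₂ _+_ refl (count-map f g xs)

  count-words-suc : ∀ (f : List Step → Bool) l →
    count f (words (suc l)) ≡ count (f ∘ (U ∷_)) (words l) + count (f ∘ (D ∷_)) (words l)
  count-words-suc f l =
    trans (count-++ f (map (U ∷_) (words l)) (map (D ∷_) (words l)))
          (cong₂ _+_ (count-map f (U ∷_) (words l)) (count-map f (D ∷_) (words l)))

  count-words-none : ∀ {f : List Step → Bool} l → (∀ w → length w ≡ l → f w ≡ false) →
    count f (words l) ≡ 0
  count-words-none zero    none rewrite none [] refl = refl
  count-words-none (suc l) none = trans (count-words-suc _ l) (cong₂ _+_
    (count-words-none l (λ w len → none (U ∷ w) (cong suc len)))
    (count-words-none l (λ w len → none (D ∷ w) (cong suc len))))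

  -- Peaks of w, where a D at the start of w also completes a peak if the step before w was U.
  peaksAfter : Bool → List Step → ℕ
  peaksAfter false w = peaks w
  peaksAfter true  w = peaks (U ∷ w)

  returns : ℤ → Bool → ℕ → ℕ → List Step → Bool
  returns h b m k w = isZeroℤ (endHeight h w) ∧ (underUps h w ≡ᵇ m) ∧ (peaksAfter b w ≡ᵇ k)

  walks : ℤ → Bool → ℕ → ℕ → ℕ → ℕ
  walks h b l m k = count (returns h b m k) (words l)

  walksBeginning : Step → ℤ → Bool → ℕ → ℕ → ℕ → ℕ
  walksBeginning s h b l m k = count (returns h b m k ∘ (s ∷_)) (words l)

  walks-suc : ∀ h b l m k → walks h b (suc l) m k ≡ walksBeginning U h b l m k + walksBeginning D h b l m k
  walks-suc h b l m k = count-words-suc (returns h b m k) l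

  returns-sound : ∀ h b m k w → returns h b m k w ≡ true → endHeight h w ≡ + 0 × underUps h w ≡ m
  returns-sound h b m k w ok
    with endHeight h w | isZeroℤ (endHeight h w) in closed | underUps h w ≡ᵇ m in flaws
  ... | + zero | true | true = refl , ℕₚ.≡ᵇ⇒≡ _ _ (subst T (sym flaws) _)

  climb-from-below : ∀ a w → endHeight -[1+ a ] w ≡ + 0 → suc a ≤ underUps -[1+ a ] w
  climb-from-below a       []      ()
  climb-from-below zero    (U ∷ w) _      = s≤s z≤n
  climb-from-below (suc a) (U ∷ w) closed = s≤s (climb-from-below a w closed)
  climb-from-below a       (D ∷ w) closed
    rewrite ℕₚ.+-identityʳ a = ℕₚ.<⇒≤ (climb-from-below (suc a) w closed)

  descent-length : ∀ n w → endHeight (+ n) w ≡ + 0 → n ≤ length w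
  descent-length zero    w       _      = z≤n
  descent-length (suc n) (U ∷ w) closed
    rewrite ℕₚ.+-comm n 1 = ℕₚ.m≤n⇒m≤1+n (ℕₚ.<⇒≤ (descent-length (suc (suc n)) w closed))
  descent-length (suc n) (D ∷ w) closed = s≤s (descent-length n w closed)

  walks-from-below : ∀ {a m} b l k → m ≤ a → walks -[1+ a ] b l m k ≡ 0
  walks-from-below {a} {m} b l k m≤a = count-words-none l λ w _ → ¬-not λ ok →
    let closed , flaws = returns-sound -[1+ a ] b m k w ok
    in ℕₚ.<-irrefl refl (ℕₚ.≤-trans (climb-from-below a w closed) (ℕₚ.≤-trans (ℕₚ.≤-reflexive flaws) m≤a))

  walks-too-high : ∀ {n l} b m k → l < n → walks (+ n) b l m k ≡ 0
  walks-too-high {n} {l} b m k l<n = count-words-none l λ w len → ¬-not λ ok →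
    let closed , _ = returns-sound (+ n) b m k w ok
    in ℕₚ.<⇒≱ l<n (subst (n ≤_) len (descent-length n w closed))

  walksBeginning-U : ∀ n b l m k → walksBeginning U (+ n) b l m k ≡ walks (+ suc n) true l m k
  walksBeginning-U n false l m k = cong (λ h → walks (+ h) true l m k) (ℕₚ.+-comm n 1)
  walksBeginning-U n true  l m k = cong (λ h → walks (+ h) true l m k) (ℕₚ.+-comm n 1)

  -- The count at k peaks, or at k - 1 peaks if b: a D right after a U completes a peak.
  peakShift : Bool → (ℕ → ℤ) → ℕ → ℤ
  peakShift false f k       = f k
  peakShift true  f zero    = + 0
  peakShift true  f (suc k) = f k

  peakShift-cong : ∀ b {f g : ℕ → ℤ} → (∀ k → f k ≡ g k) → ∀ k → peakShift b f k ≡ peakShift b g k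
  peakShift-cong false f≡g k       = f≡g k
  peakShift-cong true  f≡g zero    = refl
  peakShift-cong true  f≡g (suc k) = f≡g k

  peakShift-zero : ∀ b {f : ℕ → ℤ} → (∀ k → f k ≡ + 0) → ∀ k → peakShift b f k ≡ + 0
  peakShift-zero false f≡0 k       = f≡0 k
  peakShift-zero true  f≡0 zero    = refl
  peakShift-zero true  f≡0 (suc k) = f≡0 k

  walksBeginning-D : ∀ h b l m k →
    + walksBeginning D h b l m k ≡ peakShift b (λ k → + walks (h - + 1) false l m k) k
  walksBeginning-D h false l m k       = refl
  walksBeginning-D h true  l m (suc k) = refl
  walksBeginning-D h true  l m zero    = cong +_ (count-words-none l λ w _ →
    trans (cong (isZeroℤ (endHeight (h - + 1) w) ∧_) (∧-zeroʳ (underUps (h - + 1) w ≡ᵇ m))) (∧-zeroʳ _))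

  walks-from-minus-one : ∀ l k → walks -[1+ 0 ] false (suc l) 1 k ≡ walks (+ 0) true l 0 k
  walks-from-minus-one l k = trans (walks-suc -[1+ 0 ] false l 1 k)
    (trans (cong₂ _+_ refl (walks-from-below false l k (s≤s z≤n))) (ℕₚ.+-identityʳ _))

module ClosedForms where

  open import Data.Integer using (_+_; _-_; _*_; -_)
  open import Data.Integer.Tactic.RingSolver using (solve-∀)
  open Walks using (peakShift; peakShift-zero)
  open ≡-Reasoning

  compositions : ℕ → ℕ → ℕ
  compositions zero    zero    = 1
  compositions zero    (suc b) = 0
  compositions (suc a) zero    = 0
  compositions (suc a) (suc b) = compositions a b ℕ.+ compositions a (suc b)

  compositions-one : ∀ a → compositions (suc a) 1 ≡ 1
  compositions-one zero    = refl
  compositions-one (suc a) = compositions-one a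

  compositions-vanish : ∀ {a b} → a < b → compositions a b ≡ 0
  compositions-vanish {zero}  {suc b} _         = refl
  compositions-vanish {suc a} {suc b} (s≤s a<b) =
    cong₂ ℕ._+_ (compositions-vanish a<b) (compositions-vanish (ℕₚ.m<n⇒m<1+n a<b))

  κ : ℕ → ℕ → ℤ
  κ a b = + compositions a b

  det : ℤ → ℤ → ℤ → ℤ → ℤ
  det a b c d = a * d - b * c

  det-additive₁ : ∀ a b a′ b′ c d → (a + a′) * d - (b + b′) * c ≡ (a * d - b * c) + (a′ * d - b′ * c)
  det-additive₁ = solve-∀

  det-difference₂ : ∀ a b c d c′ d′ → (a * (d + d′) - b * (c + c′)) - (a * d′ - b * c′) ≡ a * d - b * c
  det-difference₂ = solve-∀

  det-self : ∀ a b → a * b - b * a ≡ + 0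
  det-self = solve-∀

  det-swap : ∀ a b c d → a * d - b * c ≡ - (c * b - d * a)
  det-swap = solve-∀

  -- Lindström–Gessel–Viennot: walks with u up steps and d down steps (so from height d - u) that
  -- stay weakly above the axis and have k peaks.
  nonneg : ℕ → ℕ → ℕ → ℤ
  nonneg d u k = det (κ u k) (κ u (suc k)) (κ (suc d) k) (κ (suc d) (suc k))

  nonnegΔ : ℕ → ℕ → ℕ → ℤ
  nonnegΔ d u k = nonneg (suc d) u k - nonneg d u k

  nonneg-no-peaks : ∀ d u → nonneg d u 0 ≡ κ u 0
  nonneg-no-peaks d u = begin
    κ u 0 * κ (suc d) 1 - κ u 1 * + 0 ≡⟨ cong (λ c → κ u 0 * + c - κ u 1 * + 0) (compositions-one d) ⟩
    κ u 0 * + 1 - κ u 1 * + 0         ≡⟨ simplify (κ u 0) (κ u 1) ⟩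
    κ u 0                             ∎
    where
    simplify : ∀ x y → x * + 1 - y * + 0 ≡ x
    simplify = solve-∀

  nonneg-no-ups : ∀ d k → nonneg d 0 k ≡ nonneg 0 0 k
  nonneg-no-ups d zero    = trans (nonneg-no-peaks d 0) (sym (nonneg-no-peaks 0 0))
  nonneg-no-ups d (suc k) = refl

  nonneg-vanish : ∀ {u k} d → u < k → nonneg d u k ≡ + 0
  nonneg-vanish d u<k rewrite compositions-vanish u<k | compositions-vanish (ℕₚ.m<n⇒m<1+n u<k) = refl

  nonneg-diagonal : ∀ d k → nonneg d (suc d) k ≡ + 0
  nonneg-diagonal d k = det-self (κ (suc d) k) (κ (suc d) (suc k))

  nonneg-swap : ∀ d u k → nonneg d (suc u) k ≡ - nonneg u (suc d) k
  nonneg-swap d u k = det-swap (κ (suc u) k) (κ (suc u) (suc k)) (κ (suc d) k) (κ (suc d) (suc k))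

  nonnegΔ-no-peaks : ∀ d u → nonnegΔ d u 0 ≡ + 0
  nonnegΔ-no-peaks d u =
    trans (cong₂ _-_ (nonneg-no-peaks (suc d) u) (nonneg-no-peaks d u)) (ℤₚ.+-inverseʳ (κ u 0))

  nonnegΔ-no-ups : ∀ d k → nonnegΔ d 0 k ≡ + 0
  nonnegΔ-no-ups d k =
    trans (cong₂ _-_ (nonneg-no-ups (suc d) k) (nonneg-no-ups d k)) (ℤₚ.+-inverseʳ (nonneg 0 0 k))

  -- By Pascal's rule both rows of nonneg (suc d) (suc u) (suc k) are sums of rows of smaller
  -- instances; bilinearity of the determinant does the rest.
  nonnegΔ-suc : ∀ d u k → nonnegΔ d (suc u) k ≡ nonnegΔ d u k + peakShift true (nonneg d u) k
  nonnegΔ-suc d u zero =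
    trans (nonnegΔ-no-peaks d (suc u)) (sym (trans (ℤₚ.+-identityʳ _) (nonnegΔ-no-peaks d u)))
  nonnegΔ-suc d u (suc k) = begin
    det (e₀ + e₁) (e₁ + e₂) (x + y) (y + z) - det (e₀ + e₁) (e₁ + e₂) y z
      ≡⟨ det-difference₂ (e₀ + e₁) (e₁ + e₂) x y y z ⟩
    det (e₀ + e₁) (e₁ + e₂) x y
      ≡⟨ det-additive₁ e₀ e₁ e₁ e₂ x y ⟩
    det e₀ e₁ x y + det e₁ e₂ x y
      ≡⟨ ℤₚ.+-comm (det e₀ e₁ x y) _ ⟩
    det e₁ e₂ x y + det e₀ e₁ x y
      ≡⟨ cong (_+ det e₀ e₁ x y) (det-difference₂ e₁ e₂ x y y z) ⟨
    (det e₁ e₂ (x + y) (y + z) - det e₁ e₂ y z) + det e₀ e₁ x y ∎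
    where
    e₀ = κ u k
    e₁ = κ u (suc k)
    e₂ = κ u (suc (suc k))
    x = κ (suc d) k
    y = κ (suc d) (suc k)
    z = κ (suc d) (suc (suc k))

  sub-add-cancel : ∀ x y → x - y + y ≡ x
  sub-add-cancel = solve-∀

  -- Closed forms for walks with no flaw, resp. exactly one flaw, with the conventions of nonneg
  -- and the flag of peaksAfter.
  nonnegAfter : Bool → ℕ → ℕ → ℕ → ℤ
  nonnegAfter false d       u k = nonneg d u k
  nonnegAfter true  zero    u k = nonneg 0 0 k
  nonnegAfter true  (suc d) u k = nonnegΔ d (suc u) k

  oneFlawAfter : Bool → ℕ → ℕ → ℕ → ℤ
  oneFlawAfter false d       zero    k = + 0
  oneFlawAfter false d       (suc u) k = nonneg d u k
  oneFlawAfter true  zero    u       k = + 0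
  oneFlawAfter true  (suc d) u       k = nonnegΔ d u k

  nonnegAfter-no-ups : ∀ b d k → nonnegAfter b (suc d) 0 k ≡ peakShift b (nonneg d 0) k
  nonnegAfter-no-ups false d k = trans (nonneg-no-ups (suc d) k) (sym (nonneg-no-ups d k))
  nonnegAfter-no-ups true  d k =
    trans (nonnegΔ-suc d 0 k) (trans (cong (_+ peakShift true (nonneg d 0) k) (nonnegΔ-no-ups d k))
      (ℤₚ.+-identityˡ _))

  nonnegAfter-step : ∀ b d u k →
    nonnegAfter b (suc d) (suc u) k ≡ nonnegAfter true (suc d) u k + peakShift b (nonneg d (suc u)) k
  nonnegAfter-step false d u k = sym (sub-add-cancel (nonneg (suc d) (suc u) k) (nonneg d (suc u) k))
  nonnegAfter-step true  d u k = nonnegΔ-suc d (suc u) k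

  nonnegAfter-diagonal : ∀ u k → nonnegAfter true u u k ≡ nonneg u u k
  nonnegAfter-diagonal zero    k = refl
  nonnegAfter-diagonal (suc u) k = begin
    nonneg (suc u) (suc (suc u)) k - nonneg u (suc (suc u)) k
      ≡⟨ cong₂ _-_ (nonneg-diagonal (suc u) k) (nonneg-swap u (suc u) k) ⟩
    + 0 - - nonneg (suc u) (suc u) k
      ≡⟨ simplify (nonneg (suc u) (suc u) k) ⟩
    nonneg (suc u) (suc u) k ∎
    where
    simplify : ∀ x → + 0 - - x ≡ x
    simplify = solve-∀

  oneFlawAfter-no-ups : ∀ b d k → oneFlawAfter b (suc d) 0 k ≡ peakShift b (oneFlawAfter false d 0) k
  oneFlawAfter-no-ups false d k = refl
  oneFlawAfter-no-ups true  d k = trans (nonnegΔ-no-ups d k) (sym (peakShift-zero true (λ _ → refl) k))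

  oneFlawAfter-step : ∀ b d u k →
    oneFlawAfter b (suc d) (suc u) k
      ≡ oneFlawAfter true (suc d) u k + peakShift b (oneFlawAfter false d (suc u)) k
  oneFlawAfter-step false d u k = sym (sub-add-cancel (nonneg (suc d) u k) (nonneg d u k))
  oneFlawAfter-step true  d u k = nonnegΔ-suc d u k

  nonneg-recurrence : ∀ n k →
    nonneg (suc n) n k ≡ (nonneg (suc n) (suc n) k + nonneg n n k) - (peakShift true (nonneg n n) k + + 0)
  nonneg-recurrence n k = begin
    b                           ≡⟨ rearrange b c s ⟩
    (b - c + s + c) - (s + + 0) ≡⟨ cong (λ x → (x + c) - (s + + 0)) Δ≡ ⟩
    (a + c) - (s + + 0)         ∎
    where
    a = nonneg (suc n) (suc n) k
    b = nonneg (suc n) n k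
    c = nonneg n n k
    s = peakShift true (nonneg n n) k
    Δ≡ : b - c + s ≡ a
    Δ≡ = trans (sym (nonnegΔ-suc n n k))
               (trans (cong (λ z → a - z) (nonneg-diagonal n k)) (ℤₚ.+-identityʳ a))
    rearrange : ∀ b c s → b ≡ (b - c + s + c) - (s + + 0)
    rearrange = solve-∀

module Binomials where

  open import Data.Integer using (_+_; _-_; _*_)
  open import Data.Integer.Tactic.RingSolver using (solve-∀)
  open ClosedForms using (compositions; compositions-one; nonneg)
  open ≡-Reasoning

  C-pascal : ∀ n k → + (n C k) + + (n C suc k) ≡ + (suc n C suc k)
  C-pascal n k = cong +_ (nCk+nC[k+1]≡[n+1]C[k+1] n k)

  compositions-binomial : ∀ a b → compositions (suc a) (suc b) ≡ a C b
  compositions-binomial zero    zero    = refl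
  compositions-binomial zero    (suc b) = refl
  compositions-binomial (suc a) zero    = compositions-one (suc a)
  compositions-binomial (suc a) (suc b) =
    trans (cong₂ ℕ._+_ (compositions-binomial a b) (compositions-binomial a (suc b)))
          (nCk+nC[k+1]≡[n+1]C[k+1] a b)

  nonneg-binomial : ∀ d u k →
    nonneg (suc d) (suc u) (suc k) ≡ + (u C k) * + (suc d C suc k) - + (u C suc k) * + (suc d C k)
  nonneg-binomial d u k
    rewrite compositions-binomial u k | compositions-binomial u (suc k)
          | compositions-binomial (suc d) k | compositions-binomial (suc d) (suc k) = refl

  C-absorb : ∀ n k → + suc k * + (suc n C suc k) ≡ + suc n * + (n C k)
  C-absorb zero    zero    = refl
  C-absorb zero    (suc k) = ℤₚ.*-zeroʳ (+ suc (suc k))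
  C-absorb (suc n) zero    =
    trans (ℤₚ.*-identityˡ _) (trans (cong +_ (nC1≡n (suc (suc n)))) (sym (ℤₚ.*-identityʳ _)))
  C-absorb (suc n) (suc k) = begin
    (+ 1 + K) * + (suc (suc n) C suc (suc k))
      ≡⟨ cong ((+ 1 + K) *_) (C-pascal (suc n) (suc k)) ⟨
    (+ 1 + K) * (A + B)
      ≡⟨ expand K A B ⟩
    A + K * A + (+ 1 + K) * B
      ≡⟨ cong₂ (λ x y → A + x + y) (C-absorb n k) (C-absorb n (suc k)) ⟩
    A + N * X + N * Y
      ≡⟨ collect A N X Y ⟩
    A + N * (X + Y)
      ≡⟨ cong (λ z → A + N * z) (C-pascal n k) ⟩
    A + N * A
      ≡⟨ factor A N ⟩
    (+ 1 + N) * A ∎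
    where
    K = + suc k
    N = + suc n
    A = + (suc n C suc k)
    B = + (suc n C suc (suc k))
    X = + (n C k)
    Y = + (n C suc k)
    expand : ∀ K A B → (+ 1 + K) * (A + B) ≡ A + K * A + (+ 1 + K) * B
    expand = solve-∀
    collect : ∀ A N X Y → A + N * X + N * Y ≡ A + N * (X + Y)
    collect = solve-∀
    factor : ∀ A N → A + N * A ≡ (+ 1 + N) * A
    factor = solve-∀

  C-ratio : ∀ n k → + suc k * + (n C suc k) ≡ (+ n - + k) * + (n C k)
  C-ratio n k = begin
    (+ 1 + K) * Y
      ≡⟨ unfold K X Y ⟩
    (+ 1 + K) * (X + Y) - (+ 1 + K) * X
      ≡⟨ cong (λ z → (+ 1 + K) * z - (+ 1 + K) * X) (C-pascal n k) ⟩
    (+ 1 + K) * + (suc n C suc k) - (+ 1 + K) * X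
      ≡⟨ cong (λ z → z - (+ 1 + K) * X) (C-absorb n k) ⟩
    (+ 1 + N) * X - (+ 1 + K) * X
      ≡⟨ factor N K X ⟩
    (N - K) * X ∎
    where
    K = + k
    N = + n
    X = + (n C k)
    Y = + (n C suc k)
    unfold : ∀ K X Y → (+ 1 + K) * Y ≡ (+ 1 + K) * (X + Y) - (+ 1 + K) * X
    unfold = solve-∀
    factor : ∀ N K X → (+ 1 + N) * X - (+ 1 + K) * X ≡ (N - K) * X
    factor = solve-∀

  C-expand : ∀ n k → + suc n * + (n C suc k) ≡ (+ n - + k) * + (suc n C suc k)
  C-expand n k = begin
    (+ 1 + N) * Y                 ≡⟨ split N K Y ⟩
    (+ 1 + K) * Y + (N - K) * Y   ≡⟨ cong (λ z → z + (N - K) * Y) (C-ratio n k) ⟩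
    (N - K) * X + (N - K) * Y     ≡⟨ ℤₚ.*-distribˡ-+ (N - K) X Y ⟨
    (N - K) * (X + Y)             ≡⟨ cong ((N - K) *_) (C-pascal n k) ⟩
    (N - K) * + (suc n C suc k)   ∎
    where
    K = + k
    N = + n
    X = + (n C k)
    Y = + (n C suc k)
    split : ∀ N K Y → (+ 1 + N) * Y ≡ (+ 1 + K) * Y + (N - K) * Y
    split = solve-∀

  -- Absorption writes n C k and n C suc k through suc (suc n) C suc k; the ratio of consecutive
  -- binomials then produces the factor 2.
  one-flaw-binomial : ∀ n k →
    + suc (suc n) * + suc n * (+ (n C k) * + (suc (suc n) C suc k) - + (n C suc k) * + (suc (suc n) C k))
      ≡ + 2 * (+ suc n - + k) * + (suc (suc n) C k) * + (suc (suc n) C suc k)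
  one-flaw-binomial n k = begin
    N₂ * N₁ * (X * Y - Z * W)
      ≡⟨ regroup N₂ N₁ X Y Z W ⟩
    Y * N₂ * (N₁ * X) - W * N₂ * (N₁ * Z)
      ≡⟨ cong₂ (λ a b → Y * N₂ * a - W * N₂ * b) (sym (C-absorb n k)) (C-expand n k) ⟩
    Y * N₂ * (K₁ * V) - W * N₂ * (D₀ * V)
      ≡⟨ factor Y N₂ K₁ V W D₀ ⟩
    N₂ * V * (K₁ * Y - D₀ * W)
      ≡⟨ cong (λ a → a * (K₁ * Y - D₀ * W)) (C-expand (suc n) k) ⟩
    D₁ * Y * (K₁ * Y - D₀ * W)
      ≡⟨ cong (λ a → D₁ * Y * (a - D₀ * W)) (C-ratio (suc (suc n)) k) ⟩
    D₁ * Y * (D₂ * W - D₀ * W)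
      ≡⟨ difference (+ n) (+ k) W Y ⟩
    + 2 * D₁ * W * Y ∎
    where
    N₁ = + suc n
    N₂ = + suc (suc n)
    K₁ = + suc k
    D₀ = + n - + k
    D₁ = + suc n - + k
    D₂ = + suc (suc n) - + k
    X = + (n C k)
    Z = + (n C suc k)
    V = + (suc n C suc k)
    W = + (suc (suc n) C k)
    Y = + (suc (suc n) C suc k)
    regroup : ∀ a b x y z w → a * b * (x * y - z * w) ≡ y * a * (b * x) - w * a * (b * z)
    regroup = solve-∀
    factor : ∀ y a k u w d → y * a * (k * u) - w * a * (d * u) ≡ a * u * (k * y - d * w)
    factor = solve-∀
    difference : ∀ n k w y →
      (+ 1 + n - k) * y * ((+ 1 + (+ 1 + n) - k) * w - (n - k) * w) ≡ + 2 * (+ 1 + n - k) * w * y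
    difference = solve-∀

module Counts where

  open import Data.Integer using (_+_; _-_)
  open Walks
  open ClosedForms
  open ≡-Reasoning

  walks-suc-nonneg : ∀ n b l m k →
    + walks (+ n) b (suc l) m k ≡ + walks (+ suc n) true l m k + + walksBeginning D (+ n) b l m k
  walks-suc-nonneg n b l m k =
    trans (cong +_ (walks-suc (+ n) b l m k))
          (cong (λ x → + x + + walksBeginning D (+ n) b l m k) (walksBeginning-U n b l m k))

  -- F b d u k stands for the walks with u up and d down steps, hence from height d - u.
  module FirstStep (m : ℕ) (F : Bool → ℕ → ℕ → ℕ → ℤ)
    (base : ∀ b k → + walks (+ 0) b 0 m k ≡ F b 0 0 k)
    (no-ups : ∀ b d k → F b (suc d) 0 k ≡ peakShift b (F false d 0) k)
    (step : ∀ b d u k → F b (suc d) (suc u) k ≡ F true (suc d) u k + peakShift b (F false d (suc u)) k)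
    (down-from-zero : ∀ b u k →
      + walksBeginning D (+ 0) b (u ℕ.+ suc u) m k ≡ peakShift b (F false u (suc u)) k)
    where

    walks≡ : ∀ b n u k → + walks (+ n) b (n ℕ.+ (u ℕ.+ u)) m k ≡ F b (n ℕ.+ u) u k
    walks≡ b zero    zero    k = base b k
    walks≡ b (suc n) zero    k = begin
      + walks (+ suc n) b (suc (n ℕ.+ 0)) m k
        ≡⟨ walks-suc-nonneg (suc n) b (n ℕ.+ 0) m k ⟩
      + walks (+ suc (suc n)) true (n ℕ.+ 0) m k + + walksBeginning D (+ suc n) b (n ℕ.+ 0) m k
        ≡⟨ cong₂ _+_ (cong +_ (walks-too-high true m k too-short))
                     (walksBeginning-D (+ suc n) b (n ℕ.+ 0) m k) ⟩
      + 0 + peakShift b (λ k → + walks (+ n) false (n ℕ.+ 0) m k) k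
        ≡⟨ ℤₚ.+-identityˡ _ ⟩
      peakShift b (λ k → + walks (+ n) false (n ℕ.+ 0) m k) k
        ≡⟨ peakShift-cong b (walks≡ false n zero) k ⟩
      peakShift b (F false (n ℕ.+ 0) 0) k
        ≡⟨ no-ups b (n ℕ.+ 0) k ⟨
      F b (suc (n ℕ.+ 0)) 0 k ∎
      where
      too-short : n ℕ.+ 0 < suc (suc n)
      too-short rewrite ℕₚ.+-identityʳ n = ℕₚ.m<n⇒m<1+n (ℕₚ.n<1+n n)
    walks≡ b zero    (suc u) k = begin
      + walks (+ 0) b (suc (u ℕ.+ suc u)) m k
        ≡⟨ walks-suc-nonneg 0 b (u ℕ.+ suc u) m k ⟩
      + walks (+ 1) true (u ℕ.+ suc u) m k + + walksBeginning D (+ 0) b (u ℕ.+ suc u) m k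
        ≡⟨ cong₂ _+_ (trans (cong (λ l → + walks (+ 1) true l m k) (ℕₚ.+-suc u u)) (walks≡ true 1 u k))
                     (down-from-zero b u k) ⟩
      F true (suc u) u k + peakShift b (F false u (suc u)) k
        ≡⟨ step b u u k ⟨
      F b (suc u) (suc u) k ∎
    walks≡ b (suc n) (suc u) k = begin
      + walks (+ suc n) b (suc l) m k
        ≡⟨ walks-suc-nonneg (suc n) b l m k ⟩
      + walks (+ suc (suc n)) true l m k + + walksBeginning D (+ suc n) b l m k
        ≡⟨ cong₂ _+_ (cong (λ l → + walks (+ suc (suc n)) true l m k) l≡)
                     (walksBeginning-D (+ suc n) b l m k) ⟩
      + walks (+ suc (suc n)) true (suc (suc n) ℕ.+ (u ℕ.+ u)) m k
        + peakShift b (λ k → + walks (+ n) false (n ℕ.+ (suc u ℕ.+ suc u)) m k) k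
        ≡⟨ cong₂ _+_ (walks≡ true (suc (suc n)) u k) (peakShift-cong b (walks≡ false n (suc u)) k) ⟩
      F true (suc (suc n) ℕ.+ u) u k + peakShift b (F false (n ℕ.+ suc u) (suc u)) k
        ≡⟨ cong₂ _+_ (cong (λ d → F true (suc d) u k) (ℕₚ.+-suc n u)) refl ⟨
      F true (suc (n ℕ.+ suc u)) u k + peakShift b (F false (n ℕ.+ suc u) (suc u)) k
        ≡⟨ step b (n ℕ.+ suc u) u k ⟨
      F b (suc (n ℕ.+ suc u)) (suc u) k ∎
      where
      l = n ℕ.+ suc (u ℕ.+ suc u)
      l≡ : l ≡ suc (suc n) ℕ.+ (u ℕ.+ u)
      l≡ = trans (ℕₚ.+-suc n _) (cong suc (trans (cong (n ℕ.+_) (ℕₚ.+-suc u u)) (ℕₚ.+-suc n _)))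

  walks-nonneg-base : ∀ b k → + walks (+ 0) b 0 0 k ≡ nonnegAfter b 0 0 k
  walks-nonneg-base false zero    = refl
  walks-nonneg-base false (suc k) = refl
  walks-nonneg-base true  zero    = refl
  walks-nonneg-base true  (suc k) = refl

  walks-nonneg-down-from-zero : ∀ b u k →
    + walksBeginning D (+ 0) b (u ℕ.+ suc u) 0 k ≡ peakShift b (nonneg u (suc u)) k
  walks-nonneg-down-from-zero b u k = begin
    + walksBeginning D (+ 0) b (u ℕ.+ suc u) 0 k
      ≡⟨ walksBeginning-D (+ 0) b (u ℕ.+ suc u) 0 k ⟩
    peakShift b (λ k → + walks -[1+ 0 ] false (u ℕ.+ suc u) 0 k) k
      ≡⟨ peakShift-zero b (λ k → cong +_ (walks-from-below false (u ℕ.+ suc u) k z≤n)) k ⟩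
    + 0
      ≡⟨ peakShift-zero b (nonneg-diagonal u) k ⟨
    peakShift b (nonneg u (suc u)) k ∎

  module Flawless = FirstStep 0 nonnegAfter
    walks-nonneg-base nonnegAfter-no-ups nonnegAfter-step walks-nonneg-down-from-zero

  walks-one-flaw-base : ∀ b k → + walks (+ 0) b 0 1 k ≡ oneFlawAfter b 0 0 k
  walks-one-flaw-base false k = refl
  walks-one-flaw-base true  k = refl

  walks-one-flaw-down-from-zero : ∀ b u k →
    + walksBeginning D (+ 0) b (u ℕ.+ suc u) 1 k ≡ peakShift b (nonneg u u) k
  walks-one-flaw-down-from-zero b u k =
    trans (walksBeginning-D (+ 0) b (u ℕ.+ suc u) 1 k) (peakShift-cong b from-minus-one k)
    where
    from-minus-one : ∀ k → + walks -[1+ 0 ] false (u ℕ.+ suc u) 1 k ≡ nonneg u u k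
    from-minus-one k = begin
      + walks -[1+ 0 ] false (u ℕ.+ suc u) 1 k ≡⟨ cong (λ l → + walks -[1+ 0 ] false l 1 k) (ℕₚ.+-suc u u) ⟩
      + walks -[1+ 0 ] false (suc (u ℕ.+ u)) 1 k ≡⟨ cong +_ (walks-from-minus-one (u ℕ.+ u) k) ⟩
      + walks (+ 0) true (u ℕ.+ u) 0 k          ≡⟨ Flawless.walks≡ true 0 u k ⟩
      nonnegAfter true u u k                    ≡⟨ nonnegAfter-diagonal u k ⟩
      nonneg u u k                              ∎

  module OneFlaw = FirstStep 1 oneFlawAfter
    walks-one-flaw-base oneFlawAfter-no-ups oneFlawAfter-step walks-one-flaw-down-from-zero

  length≡2n : ∀ n → 2 ℕ.* n ≡ 0 ℕ.+ (n ℕ.+ n)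
  length≡2n n = cong (n ℕ.+_) (ℕₚ.+-identityʳ n)

  p-flawless : ∀ n k → + p n 0 k ≡ nonneg n n k
  p-flawless n k = trans (cong (λ l → + walks (+ 0) false l 0 k) (length≡2n n)) (Flawless.walks≡ false 0 n k)

  p-one-flaw : ∀ n k → + p n 1 k ≡ oneFlawAfter false n n k
  p-one-flaw n k = trans (cong (λ l → + walks (+ 0) false l 1 k) (length≡2n n)) (OneFlaw.walks≡ false 0 n k)

  ≤ᵇ-false⇒> : ∀ {k n} → (k ℕ.≤ᵇ n) ≡ false → n < k
  ≤ᵇ-false⇒> e = ℕₚ.≰⇒> (λ k≤n → subst T e (ℕₚ.≤⇒≤ᵇ k≤n))

  P₀-flawless : ∀ n k → P₀ n k ≡ nonneg n n k
  P₀-flawless n k with k ℕ.≤ᵇ n in e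
  ... | true  = p-flawless n k
  ... | false = sym (nonneg-vanish n (≤ᵇ-false⇒> {k} {n} e))

  P₁-one-flaw : ∀ n k → P₁ (suc n) k ≡ nonneg (suc n) n k
  P₁-one-flaw n k with k ℕ.≤ᵇ suc n in e
  ... | true  = p-one-flaw (suc n) k
  ... | false = sym (nonneg-vanish (suc n) (ℕₚ.<-trans (ℕₚ.n<1+n n) (≤ᵇ-false⇒> {k} {suc n} e)))

  xzMul-peakShift : ∀ f n k → xzMul f (suc n) k ≡ peakShift true (f n) k
  xzMul-peakShift f n zero    = refl
  xzMul-peakShift f n (suc k) = refl

  series-identity : ∀ n k → P₁ n k ≡ ((P₀ ⊕ zMul P₀) ⊖ (xzMul P₀ ⊕ one)) n k
  series-identity zero    zero    = refl
  series-identity zero    (suc k) = refl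
  series-identity (suc n) k       = begin
    P₁ (suc n) k
      ≡⟨ P₁-one-flaw n k ⟩
    nonneg (suc n) n k
      ≡⟨ nonneg-recurrence n k ⟩
    (nonneg (suc n) (suc n) k + nonneg n n k) - (peakShift true (nonneg n n) k + + 0)
      ≡⟨ cong₂ (λ x y → x - (y + + 0)) (cong₂ _+_ (P₀-flawless (suc n) k) (P₀-flawless n k))
               (trans (xzMul-peakShift P₀ n k) (peakShift-cong true (P₀-flawless n) k)) ⟨
    ((P₀ ⊕ zMul P₀) ⊖ (xzMul P₀ ⊕ one)) (suc n) k ∎


open Counts using (series-identity; p-one-flaw)
open ClosedForms using (nonneg-no-peaks; nonneg-vanish)
open Binomials using (nonneg-binomial; one-flaw-binomial)
open import Data.Nat using (_*_; _∸_)
open import Relation.Nullary using (yes; no)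

p-one-flaw-no-peaks : ∀ n → p (suc (suc n)) 1 0 ≡ 0
p-one-flaw-no-peaks n =
  ℤₚ.+-injective (trans (p-one-flaw (suc (suc n)) 0) (nonneg-no-peaks (suc (suc n)) (suc n)))

p-one-flaw-too-many-peaks : ∀ n k → suc n < k → p (suc (suc n)) 1 (suc k) ≡ 0
p-one-flaw-too-many-peaks n k 1+n<k = ℤₚ.+-injective
  (trans (p-one-flaw (suc (suc n)) (suc k)) (nonneg-vanish (suc (suc n)) (ℕₚ.m<n⇒m<1+n 1+n<k)))

pos-*³ : ∀ a b c → + (a * b * c) ≡ + a ℤ.* + b ℤ.* + c
pos-*³ a b c = trans (ℤₚ.pos-* (a * b) c) (cong (ℤ._* + c) (ℤₚ.pos-* a b))

pos-*⁴ : ∀ a b c d → + (a * b * c * d) ≡ + a ℤ.* + b ℤ.* + c ℤ.* + d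
pos-*⁴ a b c d = trans (ℤₚ.pos-* (a * b * c) d) (cong (ℤ._* + d) (pos-*³ a b c))

p-one-flaw-formula : ∀ n k → k ≤ suc n →
  suc (suc n) * suc n * p (suc (suc n)) 1 (suc k)
    ≡ 2 * (suc n ∸ k) * (suc (suc n) C k) * (suc (suc n) C suc k)
p-one-flaw-formula n k k≤1+n = ℤₚ.+-injective (begin
  + (suc (suc n) * suc n * p (suc (suc n)) 1 (suc k))
    ≡⟨ pos-*³ (suc (suc n)) (suc n) (p (suc (suc n)) 1 (suc k)) ⟩
  + suc (suc n) ℤ.* + suc n ℤ.* + p (suc (suc n)) 1 (suc k)
    ≡⟨ cong (+ suc (suc n) ℤ.* + suc n ℤ.*_)
            (trans (p-one-flaw (suc (suc n)) (suc k)) (nonneg-binomial (suc n) n k)) ⟩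
  + suc (suc n) ℤ.* + suc n ℤ.* (+ (n C k) ℤ.* + Y ℤ.- + (n C suc k) ℤ.* + W)
    ≡⟨ one-flaw-binomial n k ⟩
  + 2 ℤ.* (+ suc n ℤ.- + k) ℤ.* + W ℤ.* + Y
    ≡⟨ cong (λ d → + 2 ℤ.* d ℤ.* + W ℤ.* + Y) (trans (ℤₚ.[+m]-[+n]≡m⊖n (suc n) k) (ℤₚ.⊖-≥ k≤1+n)) ⟩
  + 2 ℤ.* + (suc n ∸ k) ℤ.* + W ℤ.* + Y
    ≡⟨ pos-*⁴ 2 (suc n ∸ k) W Y ⟨
  + (2 * (suc n ∸ k) * W * Y) ∎)
  where
  open ≡-Reasoning
  W = suc (suc n) C k
  Y = suc (suc n) C suc k

lemma3p1 : ((n k : ℕ) → P₁ n k ≡ ((P₀ ⊕ zMul P₀) ⊖ (xzMul P₀ ⊕ one)) n k)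
    × ((n k : ℕ) → 2 ≤ n → n * (n ∸ 1) * p n 1 k ≡ 2 * (n ∸ k) * binomPred n k * (n C k))
lemma3p1 = series-identity , closed-formula
  where
  closed-formula : (n k : ℕ) → 2 ≤ n → n * (n ∸ 1) * p n 1 k ≡ 2 * (n ∸ k) * binomPred n k * (n C k)
  closed-formula (suc zero)    k       (s≤s ())
  closed-formula (suc (suc n)) zero    _ rewrite p-one-flaw-no-peaks n =
    trans (ℕₚ.*-zeroʳ (suc (suc n) * suc n)) (sym (cong (_* 1) (ℕₚ.*-zeroʳ (2 * suc (suc n)))))
  closed-formula (suc (suc n)) (suc k) _ with k ℕₚ.≤? suc n
  ... | yes k≤1+n = p-one-flaw-formula n k k≤1+n
  ... | no  k≰1+n rewrite p-one-flaw-too-many-peaks n k (ℕₚ.≰⇒> k≰1+n)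
                        | ℕₚ.m≤n⇒m∸n≡0 (ℕₚ.<⇒≤ (ℕₚ.≰⇒> k≰1+n)) = ℕₚ.*-zeroʳ (suc (suc n) * suc n)
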